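{- Let $(\mathbb P_n,\geq_n)_{n\in\mathbb N}$ be a level-injective $\omega$-chain with associated poset $(\mathbb P,\geq)$. Then for $x\in\mathbb P_m$ and $y\in\mathbb P_n$ with $m\le n$, we have $x\geq y$ if and only if $x^\in\supseteq y^\in$.
   Context: For a relation $R\subseteq A\times B$: $R$ is co-surjective if every $b\in B$ has some $a$ with $aRb$; co-injective if every $a\in A$ has some $b$ with $aRb$ such that no $a'\ne a$ has $a'Rb$. An $\omega$-chain $(\mathbb P_n,\geq_n)$ consists of finite sets $\mathbb P_n$ and co-surjective relations $\geq_n\subseteq\mathbb P_n\times\mathbb P_{n+1}$; its poset is $\mathbb P=\bigsqcup_n\mathbb P_n$ ordered by the reflexive transitive closure $\geq$ of $\bigsqcup_n\geq_n$. It is level-injective if every $\geq_n$ is co-injective. A band in $\mathbb P$ is a finite $B\subseteq\mathbb P$ such that every $p\in\mathbb P$ is comparable with some $b\in B$. A cap is a set $C\subseteq\mathbb P$ such that for some band $B$, every $b\in B$ satisfies $b\le c$ for some $c\in C$. A selector is a subset of $\mathbb P$ meeting every cap. $\mathrm{Sp}\,\mathbb P$ is the set of inclusion-minimal selectors, and for $p\in\mathbb P$, $p^\in=\{S\in\mathrm{Sp}\,\mathbb P: p\in S\}$. -}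

module Defs where

open import Level using (0ℓ)
open import Data.Nat using (ℕ; suc; _≤_)
open import Data.Fin using (Fin)
open import Data.Bool using (Bool; T)
open import Data.Product using (Σ; _×_; _,_; ∃; ∃-syntax)
open import Data.Sum using (_⊎_)
open import Data.List using (List)
open import Data.List.Membership.Propositional using (_∈_)
open import Relation.Unary using (Pred; _⊆_)
open import Relation.Binary.PropositionalEquality using (_≡_)
open import Relation.Binary.Construct.Closure.ReflexiveTransitive using (Star)

-- An ω-chain: finite sets P_n = Fin (size n), and relations ≥_n ⊆ P_n × P_{n+1}
-- (given as Bool-valued, i.e. decidable, relations between finite sets),
-- each co-surjective.
CoSurjective : {A B : Set} → (A → B → Set) → Set
CoSurjective {A} {B} R = ∀ (b : B) → ∃[ a ] R a b

CoInjective : {A B : Set} → (A → B → Set) → Set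
CoInjective {A} {B} R =
  ∀ (a : A) → ∃[ b ] (R a b × (∀ (a' : A) → R a' b → a' ≡ a))

record ωChain : Set where
  field
    size  : ℕ → ℕ
    rel   : (n : ℕ) → Fin (size n) → Fin (size (suc n)) → Bool
    cosurj : ∀ n → CoSurjective (λ a b → T (rel n a b))

module _ (C : ωChain) where
  open ωChain C

  LevelInjective : Set
  LevelInjective = ∀ n → CoInjective (λ a b → T (rel n a b))

  ℙ : Set
  ℙ = Σ ℕ (λ n → Fin (size n))

  data Step : ℙ → ℙ → Set where
    step : ∀ {n} {a : Fin (size n)} {b : Fin (size (suc n))} →
           T (rel n a b) → Step (n , a) (suc n , b)

  _≽_ : ℙ → ℙ → Set
  p ≽ q = Star Step p q

  _≼_ : ℙ → ℙ → Set
  p ≼ q = q ≽ p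

  Comparable : ℙ → ℙ → Set
  Comparable p q = (p ≼ q) ⊎ (q ≼ p)

  IsBand : List ℙ → Set
  IsBand B = ∀ (p : ℙ) → ∃[ b ] (b ∈ B × Comparable p b)

  IsCap : Pred ℙ 0ℓ → Set
  IsCap Cp = ∃[ B ] (IsBand B × (∀ b → b ∈ B → ∃[ c ] (Cp c × b ≼ c)))

  IsSelector : Pred ℙ 0ℓ → Set₁
  IsSelector S = ∀ (Cp : Pred ℙ 0ℓ) → IsCap Cp → ∃[ p ] (Cp p × S p)

  InSp : Pred ℙ 0ℓ → Set₁
  InSp S = IsSelector S × (∀ (S' : Pred ℙ 0ℓ) → IsSelector S' → S' ⊆ S → S ⊆ S')

  _∈⊇_ : ℙ → ℙ → Set₁
  x ∈⊇ y = ∀ (S : Pred ℙ 0ℓ) → InSp S → S y → S x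

-- (⇒) holds in any ω-chain: if x ≥ y and a minimal selector S contained y but not x,
-- then S without y would still be a selector, because every cap stays a cap when y is
-- replaced by x.  (⇐) Level-injectivity gives a branch y = z₀ ≥ z₁ ≥ ⋯ in which each
-- zₖ is the only element immediately above zₖ₊₁.  The up-set of this branch is a
-- minimal selector containing y, and its only members at levels ≤ n are those above y.
module Submission where

open import Defs
open import Level using (0ℓ)
open import Data.Nat using (ℕ; zero; suc; _≤_; _+_; _⊔_; z≤n; _≟_)
open import Data.Nat.Properties
open import Data.Fin using (Fin)
import Data.Fin.Properties as Fin
open import Data.Bool using (T)
open import Data.Product using (∃-syntax; _×_; _,_; proj₁; proj₂)
open import Data.Product.Properties using (≡-dec)
open import Data.Sum using (_⊎_; inj₁; inj₂)
open import Data.Empty using (⊥-elim)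
open import Data.List using (List; []; _∷_; map; allFin)
open import Data.List.Relation.Unary.Any using (here; there)
open import Data.List.Membership.Propositional using (_∈_)
open import Data.List.Membership.Propositional.Properties using (∈-map⁺; ∈-map⁻; ∈-allFin)
open import Relation.Nullary using (¬_; Dec; yes; no)
open import Relation.Binary.PropositionalEquality
open import Relation.Binary.Construct.Closure.ReflexiveTransitive using (ε; _◅_; _◅◅_)
open import Relation.Unary using (Pred; _⊆_)

module _ (C : ωChain) where
  open ωChain C

  private
    P : Set
    P = ℙ C

    _⊒_ : P → P → Set
    _⊒_ = _≽_ C

  level : P → ℕ
  level = proj₁

  _≟ℙ_ : (p q : P) → Dec (p ≡ q)
  _≟ℙ_ = ≡-dec _≟_ Fin._≟_

  ≽⇒level≤ : ∀ {p q} → p ⊒ q → level p ≤ level q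
  ≽⇒level≤ ε = ≤-refl
  ≽⇒level≤ (step {n} _ ◅ r) = ≤-trans (n≤1+n n) (≽⇒level≤ r)

  ≽∧level≡⇒≡ : ∀ {p q} → p ⊒ q → level p ≡ level q → p ≡ q
  ≽∧level≡⇒≡ ε _ = refl
  ≽∧level≡⇒≡ (step {n} _ ◅ r) eq =
    ⊥-elim (1+n≰n (subst (suc n ≤_) (sym eq) (≽⇒level≤ r)))

  ≽-lastStep : ∀ {k b w} → w ⊒ (suc k , b) → level w ≤ k →
               ∃[ a ] (w ⊒ (k , a) × T (rel k a b))
  ≽-lastStep ε le = ⊥-elim (1+n≰n le)
  ≽-lastStep {k} (step {n} {a} t ◅ r) le with n ≟ k
  ... | yes refl with ≽∧level≡⇒≡ r refl
  ...   | refl = a , ε , t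
  ≽-lastStep (step t ◅ r) le | no n≢k with ≽-lastStep r (≤∧≢⇒< le n≢k)
  ... | a , r′ , t′ = a , step t ◅ r′ , t′

  IsCap-replace : ∀ {x y} → x ⊒ y → (Cp : Pred P 0ℓ) → IsCap C Cp →
                  IsCap C (λ q → (Cp q × ¬ q ≡ y) ⊎ q ≡ x)
  IsCap-replace {x} {y} x⊒y Cp (B , band , covered) = B , band , λ b b∈B → raise (covered b b∈B)
    where
    raise : ∀ {b} → ∃[ c ] (Cp c × c ⊒ b) → ∃[ c ] (((Cp c × ¬ c ≡ y) ⊎ c ≡ x) × c ⊒ b)
    raise (c , Cc , c⊒b) with c ≟ℙ y
    ... | yes refl = x , inj₂ refl , x⊒y ◅◅ c⊒b
    ... | no c≢y = c , inj₁ (Cc , c≢y) , c⊒b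

  ≽⇒∈⊇ : ∀ {x y} → x ⊒ y → _∈⊇_ C x y
  ≽⇒∈⊇ {x} {y} x⊒y S (S-sel , S-min) Sy = proj₂ (S-min S′ S′-sel proj₁ Sy) refl
    where
    S′ : Pred P 0ℓ
    S′ q = S q × (q ≡ y → S x)

    S′-sel : IsSelector C S′
    S′-sel Cp Cp-cap with S-sel _ (IsCap-replace x⊒y Cp Cp-cap)
    ... | p , inj₁ (Cp-p , p≢y) , Sp = p , Cp-p , Sp , λ p≡y → ⊥-elim (p≢y p≡y)
    ... | _ , inj₂ refl , Sx with S-sel Cp Cp-cap
    ...   | q , Cq , Sq = q , Cq , Sq , λ _ → Sx

  maxLevel : List P → ℕ
  maxLevel [] = 0
  maxLevel (p ∷ ps) = level p ⊔ maxLevel ps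

  level≤maxLevel : ∀ {b} bs → b ∈ bs → level b ≤ maxLevel bs
  level≤maxLevel (p ∷ ps) (here refl) = m≤m⊔n (level p) (maxLevel ps)
  level≤maxLevel (p ∷ ps) (there b∈ps) =
    ≤-trans (level≤maxLevel ps b∈ps) (m≤n⊔m (level p) (maxLevel ps))

  levelList : ℕ → List P
  levelList L = map (L ,_) (allFin (size L))

  ∈-levelList : ∀ L a → (L , a) ∈ levelList L
  ∈-levelList L a = ∈-map⁺ (L ,_) (∈-allFin a)

  module _ (LI : LevelInjective C) where

    descend : ∀ {j L} → j ≤ L → ∀ c → ∃[ a ] ((j , c) ⊒ (L , a))
    descend {L = zero} z≤n c = c , ε
    descend {j} {suc L} le c with j ≟ suc L
    ... | yes refl = c , ε
    ... | no j≢L with descend (≤-pred (≤∧≢⇒< le j≢L)) c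
    ...   | a , r = proj₁ (LI L a) , r ◅◅ (step (proj₁ (proj₂ (LI L a))) ◅ ε)

    ascend : ∀ {L j} → L ≤ j → ∀ c → ∃[ a ] ((L , a) ⊒ (j , c))
    ascend {j = zero} z≤n c = c , ε
    ascend {L} {suc j} le c with L ≟ suc j
    ... | yes refl = c , ε
    ... | no L≢j with cosurj j c
    ...   | b , t with ascend (≤-pred (≤∧≢⇒< le L≢j)) b
    ...     | a , r = a , r ◅◅ (step t ◅ ε)

    levelList-band : ∀ L → IsBand C (levelList L)
    levelList-band L (j , c) with ≤-total j L
    ... | inj₁ j≤L with descend j≤L c
    ...   | a , r = (L , a) , ∈-levelList L a , inj₂ r
    levelList-band L (j , c) | inj₂ L≤j with ascend L≤j c
    ...   | a , r = (L , a) , ∈-levelList L a , inj₁ r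

    module Branch {n : ℕ} (y : Fin (size n)) where

      -- z (suc d) is the witness of co-injectivity for z d, so z d is its only predecessor.
      z : (d : ℕ) → Fin (size (d + n))
      z zero = y
      z (suc d) = proj₁ (LI (d + n) (z d))

      branch : ℕ → P
      branch d = d + n , z d

      branch-step : ∀ d → T (rel (d + n) (z d) (z (suc d)))
      branch-step d = proj₁ (proj₂ (LI (d + n) (z d)))

      branch-uniquePred : ∀ d a → T (rel (d + n) a (z (suc d))) → a ≡ z d
      branch-uniquePred d = proj₂ (proj₂ (LI (d + n) (z d)))

      ≽branch⇒≽y⊎onBranch : ∀ d {w} → w ⊒ branch d → (w ⊒ (n , y)) ⊎ (∃[ e ] w ≡ branch (suc e))
      ≽branch⇒≽y⊎onBranch zero r = inj₁ r
      ≽branch⇒≽y⊎onBranch (suc d) {w} r with level w ≟ suc d + n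
      ... | yes eq = inj₂ (d , ≽∧level≡⇒≡ r eq)
      ... | no w≢ with ≽-lastStep r (≤-pred (≤∧≢⇒< (≽⇒level≤ r) w≢))
      ...   | a , r′ , t with branch-uniquePred d a t
      ...     | refl = ≽branch⇒≽y⊎onBranch d r′

      branch-aboveRoot : ∀ e → ¬ (suc e + n ≤ n)
      branch-aboveRoot e le = 1+n≰n (≤-trans le (m≤n+m n e))

      BranchUp : Pred P 0ℓ
      BranchUp p = ∃[ d ] p ⊒ branch d

      BranchUp-lowLevel : ∀ {w} → level w ≤ n → BranchUp w → w ⊒ (n , y)
      BranchUp-lowLevel le (d , r) with ≽branch⇒≽y⊎onBranch d r
      ... | inj₁ r′ = r′
      ... | inj₂ (e , refl) = ⊥-elim (branch-aboveRoot e le)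

      BranchUp-atLevel : ∀ D {w} → level w ≡ D + n → BranchUp w → w ≡ branch D
      BranchUp-atLevel D eq (d , r) with ≽branch⇒≽y⊎onBranch d r
      BranchUp-atLevel zero eq _ | inj₁ r′ = ≽∧level≡⇒≡ r′ eq
      BranchUp-atLevel (suc D) eq _ | inj₁ r′ =
        ⊥-elim (branch-aboveRoot D (subst (_≤ n) eq (≽⇒level≤ r′)))
      BranchUp-atLevel D eq _ | inj₂ (e , w≡)
        with +-cancelʳ-≡ n D (suc e) (trans (sym eq) (cong level w≡))
      ... | refl = w≡

      -- A band is met at a level K below all its elements; whatever covers it covers branch K.
      BranchUp-selector : IsSelector C BranchUp
      BranchUp-selector Cp (B , band , covered) with band (branch (maxLevel B))
      ... | b , b∈B , cmp with covered b b∈B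
      ...   | c , Cc , c⊒b = c , Cc , maxLevel B , c⊒b ◅◅ b⊒branch cmp
        where
        b⊒branch : Comparable C (branch (maxLevel B)) b → b ⊒ branch (maxLevel B)
        b⊒branch (inj₁ r) = r
        b⊒branch (inj₂ r) = subst (_⊒ branch (maxLevel B))
          (≽∧level≡⇒≡ r (≤-antisym (≽⇒level≤ r)
            (≤-trans (level≤maxLevel B b∈B) (m≤m+n (maxLevel B) n)))) ε

      -- For p ⊒ branch d, the cap {p} ∪ (level d + n minus branch d) meets BranchUp only in p.
      BranchUp-minimal : ∀ (S : Pred P 0ℓ) → IsSelector C S → S ⊆ BranchUp → BranchUp ⊆ S
      BranchUp-minimal S S-sel S⊆ {p} (d , p⊒) with S-sel Cp Cp-cap
        where
        Cp : Pred P 0ℓ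
        Cp q = q ≡ p ⊎ (level q ≡ d + n × ¬ q ≡ branch d)

        cover : ∀ a → ∃[ c ] (Cp c × c ⊒ (d + n , a))
        cover a with (d + n , a) ≟ℙ branch d
        ... | yes refl = p , inj₁ refl , p⊒
        ... | no ≢branch = _ , inj₂ (refl , ≢branch) , ε

        Cp-cap : IsCap C Cp
        Cp-cap = levelList (d + n) , levelList-band (d + n) , λ b b∈ →
          case-member (∈-map⁻ (d + n ,_) b∈)
          where
          case-member : ∀ {b} → ∃[ a ] (a ∈ allFin (size (d + n)) × b ≡ (d + n , a)) →
                        ∃[ c ] (Cp c × c ⊒ b)
          case-member (a , _ , refl) = cover a
      ... | _ , inj₁ refl , Sp = Sp
      ... | q , inj₂ (lv , q≢) , Sq = ⊥-elim (q≢ (BranchUp-atLevel d lv (S⊆ Sq)))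

      BranchUp∈Sp : InSp C BranchUp
      BranchUp∈Sp = BranchUp-selector , BranchUp-minimal

    ∈⊇⇒≽ : ∀ {m n} (x : Fin (size m)) (y : Fin (size n)) → m ≤ n →
           _∈⊇_ C (m , x) (n , y) → (m , x) ⊒ (n , y)
    ∈⊇⇒≽ x y m≤n x∈⊇y = BranchUp-lowLevel m≤n (x∈⊇y BranchUp BranchUp∈Sp (0 , ε))
      where open Branch y

mainTheorem18 : (C : ωChain) → LevelInjective C →
    ∀ {m n : ℕ} (x : Fin (ωChain.size C m)) (y : Fin (ωChain.size C n)) →
    m ≤ n →
    (_≽_ C (m , x) (n , y) → _∈⊇_ C (m , x) (n , y))
    × (_∈⊇_ C (m , x) (n , y) → _≽_ C (m , x) (n , y))
mainTheorem18 C LI x y m≤n = ≽⇒∈⊇ C , ∈⊇⇒≽ C LI x y m≤n
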